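{- Let $n\geq 4$ and let $\mathcal{C}_n$ be the cycle of order $n$. Then $\chi_{slid}(\mathcal{C}_n)=4$ if $n\equiv 0\pmod 4$; $\chi_{slid}(\mathcal{C}_n)=6$ if $n=6$ or $n=11$; $\chi_{slid}(\mathcal{C}_7)=7$; and $\chi_{slid}(\mathcal{C}_n)=5$ otherwise. As a consequence, every finite simple graph with maximum degree $2$ has a strong locally identifying colouring with seven colours.
   Context: For a vertex $u$, $N[u]$ is its closed neighbourhood; for a colouring $c$ and vertex set $S$, $c(S)=\{c(u):u\in S\}$. A locally identifying colouring is a proper vertex colouring $c$ such that for every pair of adjacent vertices $u,v$ with $N[u]\neq N[v]$, $c(N[u])\neq c(N[v])$. A strong locally identifying colouring (slid-colouring) is a locally identifying colouring in which, for each vertex $u$, all colours in $N[u]$ are distinct (i.e. any two vertices at distance at most $2$ get different colours). $\chi_{slid}(G)$ is the minimum number of colours in a slid-colouring of $G$. -}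

module Defs where

open import Data.Nat using (ℕ; zero; suc; _≤_; _<_)
open import Data.Fin using (Fin; toℕ)
open import Data.Bool using (Bool; T)
open import Data.List using (length; filterᵇ; allFin)
open import Data.Product using (_×_; ∃; Σ)
open import Data.Sum using (_⊎_)
open import Relation.Nullary using (¬_)
open import Relation.Binary.PropositionalEquality using (_≡_; _≢_)

InClosedNbhd : {n : ℕ} → (Fin n → Fin n → Set) → Fin n → Fin n → Set
InClosedNbhd Adj u w = (u ≡ w) ⊎ Adj u w

SameClosedNbhd : {n : ℕ} → (Fin n → Fin n → Set) → Fin n → Fin n → Set
SameClosedNbhd Adj u v =
  ∀ w → (InClosedNbhd Adj u w → InClosedNbhd Adj v w) × (InClosedNbhd Adj v w → InClosedNbhd Adj u w)

ColourInNbhd : {n k : ℕ} → (Fin n → Fin n → Set) → (Fin n → Fin k) → Fin n → Fin k → Set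
ColourInNbhd Adj c u x = ∃ λ w → InClosedNbhd Adj u w × (c w ≡ x)

SameColourSet : {n k : ℕ} → (Fin n → Fin n → Set) → (Fin n → Fin k) → Fin n → Fin n → Set
SameColourSet Adj c u v =
  ∀ x → (ColourInNbhd Adj c u x → ColourInNbhd Adj c v x) × (ColourInNbhd Adj c v x → ColourInNbhd Adj c u x)

Proper : {n k : ℕ} → (Fin n → Fin n → Set) → (Fin n → Fin k) → Set
Proper Adj c = ∀ u v → Adj u v → c u ≢ c v

LocallyIdentifying : {n k : ℕ} → (Fin n → Fin n → Set) → (Fin n → Fin k) → Set
LocallyIdentifying Adj c =
  Proper Adj c ×
  (∀ u v → Adj u v → ¬ SameClosedNbhd Adj u v → ¬ SameColourSet Adj c u v)

IsSlidColouring : {n k : ℕ} → (Fin n → Fin n → Set) → (Fin n → Fin k) → Set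
IsSlidColouring Adj c =
  LocallyIdentifying Adj c ×
  (∀ u v w → InClosedNbhd Adj u v → InClosedNbhd Adj u w → v ≢ w → c v ≢ c w)

HasSlidColouring : {n : ℕ} → (Fin n → Fin n → Set) → ℕ → Set
HasSlidColouring {n} Adj k = Σ (Fin n → Fin k) (IsSlidColouring Adj)

ChiSlid≡ : {n : ℕ} → (Fin n → Fin n → Set) → ℕ → Set
ChiSlid≡ Adj k = HasSlidColouring Adj k × (∀ m → m < k → ¬ HasSlidColouring Adj m)

CycleSucc : (n : ℕ) → Fin n → Fin n → Set
CycleSucc n i j = (suc (toℕ i) ≡ toℕ j) ⊎ ((suc (toℕ i) ≡ n) × (toℕ j ≡ 0))

CycleAdj : (n : ℕ) → Fin n → Fin n → Set
CycleAdj n i j = CycleSucc n i j ⊎ CycleSucc n j i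

BoolAdj : {n : ℕ} → (Fin n → Fin n → Bool) → Fin n → Fin n → Set
BoolAdj adj u v = T (adj u v)

IsSimpleGraph : {n : ℕ} → (Fin n → Fin n → Bool) → Set
IsSimpleGraph adj = (∀ u v → adj u v ≡ adj v u) × (∀ u → ¬ T (adj u u))

degree : {n : ℕ} → (Fin n → Fin n → Bool) → Fin n → ℕ
degree {n} adj u = length (filterᵇ (adj u) (allFin n))

MaxDegree2 : {n : ℕ} → (Fin n → Fin n → Bool) → Set
MaxDegree2 adj = (∀ u → degree adj u ≤ 2) × (∃ λ u → degree adj u ≡ 2)

module Submission where

-- A colouring of the cycle is a slid-colouring exactly when any four consecutive vertices get distinct
-- colours: pairs at distance at most 2 are covered by the strong condition, and the two ends of a path
-- of length 3 are separated by local identification of its middle edge. Read around the cycle, such a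
-- colouring is an n-periodic sequence whose windows of length 4 are distinct. With four colours the
-- colour after a window is forced, so the sequence has period 4 and 4 divides n. Conversely, blocks
-- 0, 1, …, ℓ-1 with 4 ≤ ℓ ≤ k can be concatenated freely; writing n = r + 4q as r blocks of length 5
-- and q - r of length 4 uses five colours unless q < r, i.e. unless n ∈ {6, 7, 11}, where an exhaustive
-- search rules out five colours (six for n = 7) and the blocks (6), (5, 6) and (7) give the upper bounds.
-- In a graph of maximum degree 2 each vertex has at most 6 others within distance 3, so a greedy
-- colouring with 7 colours separates all such pairs, and any colouring that does is a slid-colouring.

open import Defs
open import Data.Bool using (Bool; T; _∧_)
open import Data.Bool.ListAction using (any)
open import Data.Bool.Properties using (T?; T-∧)
open import Data.Fin using (Fin; zero; suc; toℕ; fromℕ<; inject≤; _≟_)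
open import Data.Fin.Properties
  using (toℕ-injective; toℕ<n; toℕ-fromℕ<; fromℕ<-cong; inject≤-injective; injective⇒≤; all?; any?; ¬∀⟶∃¬)
open import Data.List using (List; []; _∷_; _++_; map; concatMap; filter; filterᵇ; length; lookup; allFin; replicate)
open import Data.List.Properties using (length-++; length-map; filter-notAll)
open import Data.List.Membership.Propositional using (_∈_; _∉_; lose)
open import Data.List.Membership.Propositional.Properties
  using (∈-lookup; ∈-map⁺; ∈-allFin; ∈-++⁺ˡ; ∈-concatMap⁺; ∈-filter⁺; ∈-filter⁻)
open import Data.List.Relation.Unary.All as All using (All; []; _∷_)
open import Data.List.Relation.Unary.All.Properties using (replicate⁺; ++⁺)
open import Data.List.Relation.Unary.Any using (here; there; index)
open import Data.List.Relation.Unary.Any.Properties using (any⁺; lookup-index)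
open import Data.List.Relation.Unary.AllPairs using ([]; _∷_)
open import Data.List.Relation.Unary.Unique.Propositional using (Unique)
open import Data.List.Relation.Unary.Unique.Propositional.Properties as Unique using (Unique[x∷xs]⇒x∉xs)
import Data.List.Relation.Unary.Unique.DecPropositional as UniqueDec
open import Data.Nat
  using (ℕ; zero; suc; _+_; _*_; _∸_; _≤_; _<_; _%_; _/_; z≤n; s≤s; s≤s⁻¹; pred; NonZero; >-nonZero)
open import Data.Nat.ListAction using (sum)
open import Data.Nat.ListAction.Properties using (sum-++)
open import Data.Nat.DivMod
open import Data.Nat.Properties renaming (_≟_ to _≟ℕ_)
open import Relation.Binary.Definitions using (tri<; tri≈; tri>)
open import Data.Product using (∃; ∃₂; _×_; _,_; proj₁; proj₂; swap)
open import Data.Sum using (_⊎_; inj₁; inj₂)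
open import Function using (_∘_; Injective; Equivalence)
open import Relation.Nullary using (¬_; Dec; yes; no; ¬?; contradiction)
open import Relation.Nullary.Decidable
  using (isYes; from-yes; fromWitness; decidable-stable; _⊎-dec_; _×-dec_; _→-dec_)
open import Relation.Binary.PropositionalEquality

unique⇒lookup-injective : {A : Set} {xs : List A} → Unique xs → Injective _≡_ _≡_ (lookup xs)
unique⇒lookup-injective {xs = x ∷ xs} (_ ∷ u) {zero} {zero} _ = refl
unique⇒lookup-injective {xs = x ∷ xs} (x∉ ∷ _) {zero} {suc j} e = contradiction e (All.lookup x∉ (∈-lookup j))
unique⇒lookup-injective {xs = x ∷ xs} (x∉ ∷ _) {suc i} {zero} e = contradiction (sym e) (All.lookup x∉ (∈-lookup i))
unique⇒lookup-injective {xs = x ∷ xs} (_ ∷ u) {suc i} {suc j} e = cong suc (unique⇒lookup-injective u e)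

unique⇒length≤ : {k : ℕ} {xs : List (Fin k)} → Unique xs → length xs ≤ k
unique⇒length≤ u = injective⇒≤ (unique⇒lookup-injective u)

unique-map⇒injectiveOn : {A B : Set} {f : A → B} {xs : List A} {x y : A} →
  Unique (map f xs) → x ∈ xs → y ∈ xs → f x ≡ f y → x ≡ y
unique-map⇒injectiveOn {xs = _ ∷ _} _ (here refl) (here refl) _ = refl
unique-map⇒injectiveOn {f = f} {xs = _ ∷ _} (fx∉ ∷ _) (here refl) (there y∈) e =
  contradiction e (All.lookup fx∉ (∈-map⁺ f y∈))
unique-map⇒injectiveOn {f = f} {xs = _ ∷ _} (fy∉ ∷ _) (there x∈) (here refl) e =
  contradiction (sym e) (All.lookup fy∉ (∈-map⁺ f x∈))
unique-map⇒injectiveOn {xs = _ ∷ _} (_ ∷ u) (there x∈) (there y∈) e = unique-map⇒injectiveOn u x∈ y∈ e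

covering⇒length≥ : ∀ {k} {xs : List (Fin k)} → (∀ x → x ∈ xs) → k ≤ length xs
covering⇒length≥ {xs = xs} all = injective⇒≤ {f = λ x → index (all x)} λ {x} {y} e →
  trans (lookup-index (all x)) (trans (cong (lookup xs) e) (sym (lookup-index (all y))))

module _ {d : ℕ} where
  open import Data.List.Membership.DecPropositional (_≟_ {suc d}) using (_∈?_)

  freeColour : (xs : List (Fin (suc d))) → length xs ≤ d → ∃ λ x → x ∉ xs
  freeColour xs len with any? (λ x → ¬? (x ∈? xs))
  ... | yes found = found
  ... | no none = contradiction (covering⇒length≥ λ x → decidable-stable (x ∈? xs) (λ x∉ → none (x , x∉)))
                                (<⇒≱ (s≤s len))

length-concatMap≤ : {A B : Set} (f : A → List B) {m : ℕ} (xs : List A) →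
  (∀ {x} → x ∈ xs → length (f x) ≤ m) → length (concatMap f xs) ≤ length xs * m
length-concatMap≤ f []       _     = z≤n
length-concatMap≤ f (x ∷ xs) short = begin
  length (f x ++ concatMap f xs)         ≡⟨ length-++ (f x) ⟩
  length (f x) + length (concatMap f xs) ≤⟨ +-mono-≤ (short (here refl)) (length-concatMap≤ f xs (short ∘ there)) ⟩
  _ + length xs * _                      ∎
  where open ≤-Reasoning

sum-replicate : ∀ q x → sum (replicate q x) ≡ q * x
sum-replicate zero    x = refl
sum-replicate (suc q) x = cong (x +_) (sum-replicate q x)

[i+j]%n≡[i+j%n]%n : ∀ i j n .{{_ : NonZero n}} → (i + j) % n ≡ (i + j % n) % n
[i+j]%n≡[i+j%n]%n i j n = trans (cong (λ m → (i + m) % n) (m≡m%n+[m/n]*n j n))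
  (trans (cong (_% n) (sym (+-assoc i (j % n) _))) ([m+kn]%n≡m%n (i + j % n) (j / n) n))

suc-%-cases : ∀ j n .{{_ : NonZero n}} →
  (suc (j % n) < n × suc j % n ≡ suc (j % n)) ⊎ (suc (j % n) ≡ n × suc j % n ≡ 0)
suc-%-cases j n with m≤n⇒m<n∨m≡n (m%n<n j n)
... | inj₁ lt = inj₁ (lt , trans ([i+j]%n≡[i+j%n]%n 1 j n) (m<n⇒m%n≡m lt))
... | inj₂ eq = inj₂ (eq , trans ([i+j]%n≡[i+j%n]%n 1 j n) (trans (cong (_% n) eq) (n%n≡0 n)))

∸-<-+ : ∀ {i ℓ s} → ℓ ≤ i → i < ℓ + s → i ∸ ℓ < s
∸-<-+ {i} {ℓ} {s} ℓ≤i lt = subst (i ∸ ℓ <_) (m+n∸m≡n ℓ s) (∸-monoˡ-< lt ℓ≤i)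

[i+r]%n≢r : ∀ {i r n} .{{_ : NonZero n}} → 0 < i → i < n → r < n → (i + r) % n ≢ r
[i+r]%n≢r {i} {r} {n} 0<i i<n r<n eq with i + r <? n
... | yes lt = >⇒≢ 0<i (+-cancelʳ-≡ r i 0 (trans (sym (m<n⇒m%n≡m lt)) eq))
... | no ≮n = <-irrefl eq (begin-strict
  (i + r) % n       ≡⟨ m≤n⇒[n∸m]%m≡n%m n≤i+r ⟨
  (i + r ∸ n) % n   ≤⟨ m%n≤m (i + r ∸ n) n ⟩
  i + r ∸ n         <⟨ ∸-<-+ n≤i+r (+-monoˡ-< r i<n) ⟩
  r                 ∎)
  where
  open ≤-Reasoning
  n≤i+r : n ≤ i + r
  n≤i+r = ≮⇒≥ ≮n

-- Periodic sequences with distinct windows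

Window : {A : Set} → A → A → A → A → Set
Window a b c d = Unique (a ∷ b ∷ c ∷ d ∷ [])

HasDistinctWindows : {A : Set} → (ℕ → A) → Set
HasDistinctWindows g = ∀ j → Window (g j) (g (1 + j)) (g (2 + j)) (g (3 + j))

Periodic : {A : Set} → ℕ → (ℕ → A) → Set
Periodic n g = ∀ j → g (j + n) ≡ g j

record WindowSequence (n k : ℕ) : Set where
  field
    colour   : ℕ → Fin k
    periodic : Periodic n colour
    windows  : HasDistinctWindows colour

open WindowSequence

windows⇒4≤colours : {k : ℕ} {g : ℕ → Fin k} → HasDistinctWindows g → 4 ≤ k
windows⇒4≤colours w = unique⇒length≤ (w 0)

noWindowSequence-3 : ∀ {n} → ¬ WindowSequence n 3
noWindowSequence-3 ws = contradiction (windows⇒4≤colours (windows ws)) λ { (s≤s (s≤s (s≤s ()))) }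

periodic-* : {A : Set} {n : ℕ} {g : ℕ → A} → Periodic n g → ∀ q j → g (j + q * n) ≡ g j
periodic-* {n = n} {g} p zero j = cong g (+-identityʳ j)
periodic-* {n = n} {g} p (suc q) j = begin
  g (j + (n + q * n)) ≡⟨ cong g (+-assoc j n (q * n)) ⟨
  g (j + n + q * n)   ≡⟨ periodic-* p q (j + n) ⟩
  g (j + n)           ≡⟨ p j ⟩
  g j                 ∎
  where open ≡-Reasoning

periodic-% : {A : Set} {n : ℕ} .{{_ : NonZero n}} {g : ℕ → A} → Periodic n g → ∀ j → g (j % n) ≡ g j
periodic-% {n = n} {g} p j = trans (sym (periodic-* p (j / n) (j % n))) (cong g (sym (m≡m%n+[m/n]*n j n)))

-- The colour after a window avoids the window's last three colours, so with four colours it repeats the first.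
windows⇒periodic4 : {g : ℕ → Fin 4} → HasDistinctWindows g → Periodic 4 g
windows⇒periodic4 {g} w j = trans (cong g (+-comm j 4)) (decidable-stable (g (4 + j) ≟ g j) λ ne →
  contradiction (unique⇒length≤ (new ne ∷ w j)) λ { (s≤s (s≤s (s≤s (s≤s ())))) })
  where
  new : g (4 + j) ≢ g j → All (g (4 + j) ≢_) (g j ∷ g (1 + j) ∷ g (2 + j) ∷ g (3 + j) ∷ [])
  new ne with w (1 + j)
  ... | (_ ∷ _ ∷ b≢e ∷ []) ∷ (_ ∷ c≢e ∷ []) ∷ (d≢e ∷ []) ∷ [] ∷ [] =
    ne ∷ ≢-sym b≢e ∷ ≢-sym c≢e ∷ ≢-sym d≢e ∷ []

windowSequence4⇒n%4≡0 : ∀ {n} → WindowSequence n 4 → n % 4 ≡ 0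
windowSequence4⇒n%4≡0 {n} ws = first-repeat (n % 4) (m%n<n n 4) g[n%4]≡g0
  where
  g = colour ws
  g[n%4]≡g0 : g (n % 4) ≡ g 0
  g[n%4]≡g0 = trans (periodic-% (windows⇒periodic4 (windows ws)) n) (periodic ws 0)
  first-repeat : ∀ r → r < 4 → g r ≡ g 0 → r ≡ 0
  first-repeat r r<4 e with windows ws 0
  first-repeat 0 _ e | _ = refl
  first-repeat 1 _ e | (0≢1 ∷ _) ∷ _ = contradiction (sym e) 0≢1
  first-repeat 2 _ e | (_ ∷ 0≢2 ∷ _) ∷ _ = contradiction (sym e) 0≢2
  first-repeat 3 _ e | (_ ∷ _ ∷ 0≢3 ∷ _) ∷ _ = contradiction (sym e) 0≢3
  first-repeat (suc (suc (suc (suc _)))) (s≤s (s≤s (s≤s (s≤s ())))) _ | _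

windowSequence-mono : ∀ {n k k′} → k ≤ k′ → WindowSequence n k → WindowSequence n k′
windowSequence-mono k≤k′ ws = record
  { colour   = λ j → inject≤ (colour ws j) k≤k′
  ; periodic = λ j → cong (λ x → inject≤ x k≤k′) (periodic ws j)
  ; windows  = λ j → Unique.map⁺ (inject≤-injective k≤k′ k≤k′ _ _) (windows ws j)
  }

windows-≗ : {A : Set} {f g : ℕ → A} → (∀ j → f j ≡ g j) → HasDistinctWindows f → HasDistinctWindows g
windows-≗ eq w j rewrite sym (eq j) | sym (eq (1 + j)) | sym (eq (2 + j)) | sym (eq (3 + j)) = w j

-- Counters built from blocks

data CounterStep : ℕ → ℕ → Set where
  count : ∀ {x} → CounterStep x (suc x)
  reset : ∀ {x} → 3 ≤ x → CounterStep x 0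

counterSteps⇒window : ∀ {a b c d} → CounterStep a b → CounterStep b c → CounterStep c d → Window a b c d
counterSteps⇒window {a} count count count =
  (m≢1+n+m a {0} ∷ m≢1+n+m a {1} ∷ m≢1+n+m a {2} ∷ [])
  ∷ (m≢1+n+m (1 + a) {0} ∷ m≢1+n+m (1 + a) {1} ∷ []) ∷ (m≢1+n+m (2 + a) {0} ∷ []) ∷ [] ∷ []
counterSteps⇒window (reset 3≤a) count count =
  (>⇒≢ (≤-trans (s≤s z≤n) 3≤a) ∷ >⇒≢ (≤-trans (s≤s (s≤s z≤n)) 3≤a) ∷ >⇒≢ 3≤a ∷ [])
  ∷ ((λ ()) ∷ (λ ()) ∷ []) ∷ ((λ ()) ∷ []) ∷ [] ∷ []
counterSteps⇒window {a} count (reset (s≤s 2≤a)) count =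
  (m≢1+n+m a {0} ∷ a≢0 ∷ >⇒≢ 2≤a ∷ [])
  ∷ ((λ ()) ∷ a≢0 ∘ suc-injective ∷ []) ∷ ((λ ()) ∷ []) ∷ [] ∷ []
  where
  a≢0 : a ≢ 0
  a≢0 = >⇒≢ (≤-trans (s≤s z≤n) 2≤a)
counterSteps⇒window {a} count count (reset (s≤s (s≤s 1≤a))) =
  (m≢1+n+m a {0} ∷ m≢1+n+m a {1} ∷ >⇒≢ 1≤a ∷ [])
  ∷ (m≢1+n+m (1 + a) {0} ∷ (λ ()) ∷ []) ∷ ((λ ()) ∷ []) ∷ [] ∷ []
counterSteps⇒window (reset _) count (reset (s≤s ()))
counterSteps⇒window _ (reset _) (reset ())
counterSteps⇒window (reset _) (reset ()) _

blockPosition : List ℕ → ℕ → ℕ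
blockPosition []       i = i
blockPosition (ℓ ∷ ℓs) i with i <? ℓ
... | yes _ = i
... | no  _ = blockPosition ℓs (i ∸ ℓ)

blockPosition-zero : ∀ ℓs → blockPosition ℓs 0 ≡ 0
blockPosition-zero []       = refl
blockPosition-zero (ℓ ∷ ℓs) with 0 <? ℓ
... | yes _ = refl
... | no  _ rewrite 0∸n≡0 ℓ = blockPosition-zero ℓs

blockPosition-< : ∀ {k ℓs i} → All (_≤ k) ℓs → i < sum ℓs → blockPosition ℓs i < k
blockPosition-< {ℓs = ℓ ∷ ℓs} {i} (ℓ≤k ∷ bs) lt with i <? ℓ
... | yes i<ℓ = <-≤-trans i<ℓ ℓ≤k
... | no  i≮ℓ = blockPosition-< bs (∸-<-+ (≮⇒≥ i≮ℓ) lt)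

blockPosition-step : ∀ {ℓs i} → All (4 ≤_) ℓs → suc i < sum ℓs →
  CounterStep (blockPosition ℓs i) (blockPosition ℓs (suc i))
blockPosition-step {ℓ ∷ ℓs} {i} (4≤ℓ ∷ hs) lt with suc i <? ℓ | i <? ℓ
... | yes _     | yes _   = count
... | yes 1+i<ℓ | no i≮ℓ  = contradiction (<-trans (n<1+n i) 1+i<ℓ) i≮ℓ
... | no 1+i≮ℓ  | yes i<ℓ =
  subst (CounterStep i) (sym (trans (cong (blockPosition ℓs) (m≤n⇒m∸n≡0 i<ℓ)) (blockPosition-zero ℓs)))
    (reset (s≤s⁻¹ (≤-trans 4≤ℓ (≮⇒≥ 1+i≮ℓ))))
... | no _      | no i≮ℓ  =
  subst (CounterStep _) (cong (blockPosition ℓs) (sym (+-∸-assoc 1 ℓ≤i)))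
    (blockPosition-step hs (subst (_< sum ℓs) (+-∸-assoc 1 ℓ≤i) (∸-<-+ (m≤n⇒m≤1+n ℓ≤i) lt)))
  where
  ℓ≤i : ℓ ≤ i
  ℓ≤i = ≮⇒≥ i≮ℓ

blockPosition-last : ∀ {ℓs i} → All (4 ≤_) ℓs → suc i ≡ sum ℓs → 3 ≤ blockPosition ℓs i
blockPosition-last {ℓ ∷ ℓs} {i} (4≤ℓ ∷ hs) eq with i <? ℓ
... | yes _   = s≤s⁻¹ (≤-trans 4≤ℓ (subst (ℓ ≤_) (sym eq) (m≤m+n ℓ (sum ℓs))))
... | no i≮ℓ  = blockPosition-last hs
  (trans (sym (+-∸-assoc 1 (≮⇒≥ i≮ℓ))) (trans (cong (_∸ ℓ) eq) (m+n∸m≡n ℓ (sum ℓs))))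

-- Repeating the blocks 0, 1, …, ℓ-1 (4 ≤ ℓ ≤ k) periodically gives a counter that resets only from values ≥ 3.
blocks⇒windowSequence : ∀ {n k} ℓs → sum ℓs ≡ n → .{{_ : NonZero n}} →
  All (λ ℓ → 4 ≤ ℓ × ℓ ≤ k) ℓs → WindowSequence n k
blocks⇒windowSequence {n} ℓs refl bs = record
  { colour   = colour′
  ; periodic = λ j → fromℕ<-cong _ _ (cong (blockPosition ℓs) ([m+n]%n≡m%n j n)) _ _
  ; windows  = λ j → Unique.map⁻ {f = toℕ}
      (counterSteps⇒window (colour-step j) (colour-step (1 + j)) (colour-step (2 + j)))
  }
  where
  position : ℕ → ℕ
  position j = blockPosition ℓs (j % n)

  position-step : ∀ j → CounterStep (position j) (position (suc j))
  position-step j with suc-%-cases j n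
  ... | inj₁ (lt , eq)  rewrite eq = blockPosition-step (All.map proj₁ bs) lt
  ... | inj₂ (eq , eq0) rewrite eq0 | blockPosition-zero ℓs = reset (blockPosition-last (All.map proj₁ bs) eq)

  colour′ : ℕ → Fin _
  colour′ j = fromℕ< (blockPosition-< (All.map proj₂ bs) (m%n<n j n))

  colour-step : ∀ j → CounterStep (toℕ (colour′ j)) (toℕ (colour′ (suc j)))
  colour-step j = subst₂ CounterStep (sym (toℕ-fromℕ< _)) (sym (toℕ-fromℕ< _)) (position-step j)

fourColourSequence : ∀ {n} .{{_ : NonZero n}} → n % 4 ≡ 0 → WindowSequence n 4
fourColourSequence {n} n%4≡0 = blocks⇒windowSequence (replicate (n / 4) 4)
  (trans (sum-replicate (n / 4) 4) (sym (trans (m≡m%n+[m/n]*n n 4) (cong (_+ n / 4 * 4) n%4≡0))))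
  (replicate⁺ (n / 4) (≤-refl , ≤-refl))

-- n = r + 4q is a sum of r blocks of length 5 and q - r blocks of length 4 as soon as r ≤ q.
fiveColourSequence : ∀ {n} .{{_ : NonZero n}} → n % 4 ≤ n / 4 → WindowSequence n 5
fiveColourSequence {n} r≤q = blocks⇒windowSequence (replicate r 5 ++ replicate (q ∸ r) 4) sum≡n
  (++⁺ (replicate⁺ r (n≤1+n 4 , ≤-refl)) (replicate⁺ (q ∸ r) (≤-refl , n≤1+n 4)))
  where
  r q : ℕ
  r = n % 4
  q = n / 4
  sum≡n : sum (replicate r 5 ++ replicate (q ∸ r) 4) ≡ n
  sum≡n = begin
    sum (replicate r 5 ++ replicate (q ∸ r) 4) ≡⟨ sum-++ (replicate r 5) _ ⟩
    sum (replicate r 5) + sum (replicate (q ∸ r) 4) ≡⟨ cong₂ _+_ (sum-replicate r 5) (sum-replicate (q ∸ r) 4) ⟩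
    r * 5 + (q ∸ r) * 4       ≡⟨ cong (_+ (q ∸ r) * 4) (*-suc r 4) ⟩
    r + r * 4 + (q ∸ r) * 4   ≡⟨ +-assoc r (r * 4) _ ⟩
    r + (r * 4 + (q ∸ r) * 4) ≡⟨ cong (r +_) (*-distribʳ-+ 4 r (q ∸ r)) ⟨
    r + (r + (q ∸ r)) * 4     ≡⟨ cong (λ m → r + m * 4) (m+[n∸m]≡n r≤q) ⟩
    r + q * 4                 ≡⟨ m≡m%n+[m/n]*n n 4 ⟨
    n                         ∎
    where open ≡-Reasoning

residue≤quotient : ∀ r q → r < 4 → 4 ≤ r + q * 4 →
  r + q * 4 ≢ 6 → r + q * 4 ≢ 7 → r + q * 4 ≢ 11 → r ≤ q
residue≤quotient 0 _ _ _ _ _ _ = z≤n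
residue≤quotient r 0 r<4 4≤r _ _ _ = contradiction r<4 (≤⇒≯ (subst (4 ≤_) (+-identityʳ r) 4≤r))
residue≤quotient 1 (suc _) _ _ _ _ _ = s≤s z≤n
residue≤quotient 2 1 _ _ ≢6 _ _ = contradiction refl ≢6
residue≤quotient 2 (suc (suc _)) _ _ _ _ _ = s≤s (s≤s z≤n)
residue≤quotient 3 1 _ _ _ ≢7 _ = contradiction refl ≢7
residue≤quotient 3 2 _ _ _ _ ≢11 = contradiction refl ≢11
residue≤quotient 3 (suc (suc (suc _))) _ _ _ _ _ = s≤s (s≤s (s≤s z≤n))
residue≤quotient (suc (suc (suc (suc _)))) _ (s≤s (s≤s (s≤s (s≤s ())))) _ _ _ _

-- Exhaustive search

window? : ∀ {k} (a b c d : Fin k) → Bool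
window? {k} a b c d = isYes (UniqueDec.unique? (_≟_ {k}) (a ∷ b ∷ c ∷ d ∷ []))

window?-complete : ∀ {k} {a b c d : Fin k} → Window a b c d → T (window? a b c d)
window?-complete = fromWitness

-- T (closes? t a b c p q r): some x₁ … x_t makes every window of a b c x₁ … x_t p q r distinct.
closes? : ∀ {k} → ℕ → (a b c p q r : Fin k) → Bool
closes? zero    a b c p q r = window? a b c p ∧ window? b c p q ∧ window? c p q r
closes? {k} (suc t) a b c p q r = any (λ x → window? a b c x ∧ closes? t b c x p q r) (allFin k)

closes?-complete : ∀ {k} t {g : ℕ → Fin k} → HasDistinctWindows g →
  T (closes? t (g 0) (g 1) (g 2) (g (3 + t)) (g (4 + t)) (g (5 + t)))
closes?-complete zero w =
  Equivalence.from T-∧ (window?-complete (w 0) , Equivalence.from T-∧ (window?-complete (w 1) , window?-complete (w 2)))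
closes?-complete (suc t) {g} w =
  any⁺ _ (lose (∈-allFin (g 3)) (Equivalence.from T-∧ (window?-complete (w 0) , closes?-complete t (w ∘ suc))))

-- No cyclic word of length 3 + t over k colours has all its windows distinct.
NoCyclicWord : ℕ → ℕ → Set
NoCyclicWord k t = ∀ (a b c : Fin k) → ¬ T (closes? t a b c a b c)

noCyclicWord? : ∀ k t → Dec (NoCyclicWord k t)
noCyclicWord? k t = all? λ a → all? λ b → all? λ c → ¬? (T? (closes? t a b c a b c))

noCyclicWord⇒noWindowSequence : ∀ {k} t → NoCyclicWord k t → ¬ WindowSequence (3 + t) k
noCyclicWord⇒noWindowSequence t none ws =
  none (g 0) (g 1) (g 2) (closed (periodic ws 0) (periodic ws 1) (periodic ws 2) (closes?-complete t (windows ws)))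
  where
  g = colour ws
  closed : ∀ {p q r} → p ≡ g 0 → q ≡ g 1 → r ≡ g 2 →
    T (closes? t (g 0) (g 1) (g 2) p q r) → T (closes? t (g 0) (g 1) (g 2) (g 0) (g 1) (g 2))
  closed refl refl refl h = h

noCyclicWord-length6-colours5 : NoCyclicWord 5 3
noCyclicWord-length6-colours5 = from-yes (noCyclicWord? 5 3)

noCyclicWord-length7-colours6 : NoCyclicWord 6 4
noCyclicWord-length7-colours6 = from-yes (noCyclicWord? 6 4)

noCyclicWord-length11-colours5 : NoCyclicWord 5 8
noCyclicWord-length11-colours5 = from-yes (noCyclicWord? 5 8)

-- Slid-colourings of cycles

module _ {n : ℕ} where

  cycleSucc-functional : ∀ {u v w} → CycleSucc n u v → CycleSucc n u w → v ≡ w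
  cycleSucc-functional (inj₁ e) (inj₁ e′) = toℕ-injective (trans (sym e) e′)
  cycleSucc-functional {v = v} (inj₁ e) (inj₂ (e′ , _)) = contradiction (toℕ<n v) (<-irrefl (trans (sym e) e′))
  cycleSucc-functional {w = w} (inj₂ (e , _)) (inj₁ e′) = contradiction (toℕ<n w) (<-irrefl (trans (sym e′) e))
  cycleSucc-functional (inj₂ (_ , z)) (inj₂ (_ , z′)) = toℕ-injective (trans z (sym z′))

  cycleSucc-injective : ∀ {u v w} → CycleSucc n u w → CycleSucc n v w → u ≡ v
  cycleSucc-injective (inj₁ e) (inj₁ e′) = toℕ-injective (suc-injective (trans e (sym e′)))
  cycleSucc-injective (inj₁ e) (inj₂ (_ , z)) = contradiction (trans e z) λ ()
  cycleSucc-injective (inj₂ (_ , z)) (inj₁ e′) = contradiction (trans e′ z) λ ()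
  cycleSucc-injective (inj₂ (e , _)) (inj₂ (e′ , _)) = toℕ-injective (suc-injective (trans e (sym e′)))

  cycleSucc-irreflexive : 2 ≤ n → ∀ {u} → ¬ CycleSucc n u u
  cycleSucc-irreflexive _ (inj₁ e) = 1+n≢n e
  cycleSucc-irreflexive 2≤n (inj₂ (e , z)) =
    contradiction (subst (2 ≤_) (trans (sym e) (cong suc z)) 2≤n) λ { (s≤s ()) }

module CycleColouring {n : ℕ} (4≤n : 4 ≤ n) where

  instance
    n≢0 : NonZero n
    n≢0 = >-nonZero (≤-trans (s≤s z≤n) 4≤n)

  N : Fin n → Fin n → Set
  N = InClosedNbhd (CycleAdj n)

  vertex : ℕ → Fin n
  vertex j = j mod n

  toℕ-vertex : ∀ j → toℕ (vertex j) ≡ j % n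
  toℕ-vertex j = toℕ-fromℕ< (m%n<n j n)

  vertex-toℕ : ∀ u → vertex (toℕ u) ≡ u
  vertex-toℕ u = toℕ-injective (trans (toℕ-vertex (toℕ u)) (m<n⇒m%n≡m (toℕ<n u)))

  vertex-periodic : Periodic n vertex
  vertex-periodic j = toℕ-injective (trans (toℕ-vertex (j + n)) (trans ([m+n]%n≡m%n j n) (sym (toℕ-vertex j))))

  vertex-shift-≢ : ∀ i j → 0 < i → i < 4 → vertex j ≢ vertex (i + j)
  vertex-shift-≢ i j 0<i i<4 eq = [i+r]%n≢r 0<i (<-≤-trans i<4 4≤n) (m%n<n j n) (begin
    (i + j % n) % n      ≡⟨ [i+j]%n≡[i+j%n]%n i j n ⟨
    (i + j) % n          ≡⟨ toℕ-vertex (i + j) ⟨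
    toℕ (vertex (i + j)) ≡⟨ cong toℕ eq ⟨
    toℕ (vertex j)       ≡⟨ toℕ-vertex j ⟩
    j % n                ∎)
    where open ≡-Reasoning

  vertex-suc-surjective : ∀ u → ∃ λ j → u ≡ vertex (suc j)
  vertex-suc-surjective u = toℕ u + pred n , (begin
    u                           ≡⟨ vertex-toℕ u ⟨
    vertex (toℕ u)              ≡⟨ vertex-periodic (toℕ u) ⟨
    vertex (toℕ u + n)          ≡⟨ cong (λ m → vertex (toℕ u + m)) (suc-pred n) ⟨
    vertex (toℕ u + suc (pred n)) ≡⟨ cong vertex (+-suc (toℕ u) (pred n)) ⟩
    vertex (suc (toℕ u + pred n)) ∎)
    where open ≡-Reasoning

  cycleSucc-vertex : ∀ j → CycleSucc n (vertex j) (vertex (suc j))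
  cycleSucc-vertex j with suc-%-cases j n
  ... | inj₁ (_ , eq)   = inj₁ (trans (cong suc (toℕ-vertex j)) (sym (trans (toℕ-vertex (suc j)) eq)))
  ... | inj₂ (eq , eq0) = inj₂ (trans (cong suc (toℕ-vertex j)) eq , trans (toℕ-vertex (suc j)) eq0)

  closedNbhd : ℕ → List (Fin n)
  closedNbhd j = vertex j ∷ vertex (1 + j) ∷ vertex (2 + j) ∷ []

  windowVertices : ℕ → List (Fin n)
  windowVertices j = closedNbhd j ++ vertex (3 + j) ∷ []

  self∈N : ∀ u → N u u
  self∈N u = inj₁ refl

  next∈N : ∀ j → N (vertex j) (vertex (suc j))
  next∈N j = inj₂ (inj₁ (cycleSucc-vertex j))

  prev∈N : ∀ j → N (vertex (suc j)) (vertex j)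
  prev∈N j = inj₂ (inj₂ (cycleSucc-vertex j))

  N⇒∈closedNbhd : ∀ j {w} → N (vertex (suc j)) w → w ∈ closedNbhd j
  N⇒∈closedNbhd j (inj₁ refl) = there (here refl)
  N⇒∈closedNbhd j (inj₂ (inj₁ s)) = there (there (here (cycleSucc-functional s (cycleSucc-vertex (suc j)))))
  N⇒∈closedNbhd j (inj₂ (inj₂ s)) = here (cycleSucc-injective s (cycleSucc-vertex j))

  module _ {k : ℕ} (c : Fin n → Fin k) where

    windows⇒slid : HasDistinctWindows (c ∘ vertex) → IsSlidColouring (CycleAdj n) c
    windows⇒slid w = (proper , identifying) , distinct
      where
      distinct : ∀ u v v′ → N u v → N u v′ → v ≢ v′ → c v ≢ c v′
      distinct u v v′ nv nv′ ne with vertex-suc-surjective u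
      ... | j , refl = ne ∘ unique-map⇒injectiveOn {f = c} {xs = windowVertices j} (w j)
                               (∈-++⁺ˡ (N⇒∈closedNbhd j nv)) (∈-++⁺ˡ (N⇒∈closedNbhd j nv′))

      proper : ∀ u v → CycleAdj n u v → c u ≢ c v
      proper u v a = distinct u u v (self∈N u) (inj₂ a) (adj≢ a)
        where
        adj≢ : ∀ {u v} → CycleAdj n u v → u ≢ v
        adj≢ (inj₁ s) refl = cycleSucc-irreflexive (≤-trans (s≤s (s≤s z≤n)) 4≤n) s
        adj≢ (inj₂ s) refl = cycleSucc-irreflexive (≤-trans (s≤s (s≤s z≤n)) 4≤n) s

      -- The colour of vertex j is seen from vertex j+1 but, by the window at j, not from vertex j+2.
      separated : ∀ j → ¬ SameColourSet (CycleAdj n) c (vertex (1 + j)) (vertex (2 + j))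
      separated j same with proj₁ (same (c (vertex j))) (vertex j , prev∈N j , refl)
      ... | x , nx , e =
        Unique[x∷xs]⇒x∉xs (w j) (subst (_∈ map c (closedNbhd (suc j))) e (∈-map⁺ c (N⇒∈closedNbhd (suc j) nx)))

      succ-separated : ∀ {u v} → CycleSucc n u v → ¬ SameColourSet (CycleAdj n) c u v
      succ-separated {u} s with vertex-suc-surjective u
      ... | j , refl with cycleSucc-functional s (cycleSucc-vertex (suc j))
      ... | refl = separated j

      identifying : ∀ u v → CycleAdj n u v → ¬ SameClosedNbhd (CycleAdj n) u v → ¬ SameColourSet (CycleAdj n) c u v
      identifying u v (inj₁ s) _ = succ-separated s
      identifying u v (inj₂ s) _ same = succ-separated s (swap ∘ same)

    slid⇒windows : IsSlidColouring (CycleAdj n) c → HasDistinctWindows (c ∘ vertex)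
    slid⇒windows ((_ , identifying) , distinct) j =
      (ab ∷ ac ∷ ad ∷ []) ∷ (bc ∷ bd ∷ []) ∷ (cd ∷ []) ∷ [] ∷ []
      where
      1-apart : ∀ i → vertex i ≢ vertex (1 + i)
      1-apart i = vertex-shift-≢ 1 i (s≤s z≤n) (s≤s (s≤s z≤n))
      2-apart : ∀ i → vertex i ≢ vertex (2 + i)
      2-apart i = vertex-shift-≢ 2 i (s≤s z≤n) (s≤s (s≤s (s≤s z≤n)))
      3-apart : ∀ i → vertex i ≢ vertex (3 + i)
      3-apart i = vertex-shift-≢ 3 i (s≤s z≤n) (s≤s (s≤s (s≤s (s≤s z≤n))))

      ab = distinct (vertex (1 + j)) (vertex j) (vertex (1 + j)) (prev∈N j) (self∈N _) (1-apart j)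
      ac = distinct (vertex (1 + j)) (vertex j) (vertex (2 + j)) (prev∈N j) (next∈N (1 + j)) (2-apart j)
      bc = distinct (vertex (1 + j)) (vertex (1 + j)) (vertex (2 + j)) (self∈N _) (next∈N (1 + j)) (1-apart (1 + j))
      bd = distinct (vertex (2 + j)) (vertex (1 + j)) (vertex (3 + j)) (prev∈N (1 + j)) (next∈N (2 + j)) (2-apart (1 + j))
      cd = distinct (vertex (2 + j)) (vertex (2 + j)) (vertex (3 + j)) (self∈N _) (next∈N (2 + j)) (1-apart (2 + j))

      nbhds-differ : ¬ SameClosedNbhd (CycleAdj n) (vertex (1 + j)) (vertex (2 + j))
      nbhds-differ same with N⇒∈closedNbhd (suc j) (proj₁ (same (vertex j)) (prev∈N j))
      ... | here e                 = 1-apart j e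
      ... | there (here e)         = 2-apart j e
      ... | there (there (here e)) = 3-apart j e

      same-colours : c (vertex j) ≡ c (vertex (3 + j)) → SameColourSet (CycleAdj n) c (vertex (1 + j)) (vertex (2 + j))
      same-colours eq x = forward , backward
        where
        forward : ColourInNbhd (CycleAdj n) c (vertex (1 + j)) x → ColourInNbhd (CycleAdj n) c (vertex (2 + j)) x
        forward (w , nw , e) with N⇒∈closedNbhd j nw
        ... | here refl = vertex (3 + j) , next∈N (2 + j) , trans (sym eq) e
        ... | there (here refl) = vertex (1 + j) , prev∈N (1 + j) , e
        ... | there (there (here refl)) = vertex (2 + j) , self∈N _ , e
        backward : ColourInNbhd (CycleAdj n) c (vertex (2 + j)) x → ColourInNbhd (CycleAdj n) c (vertex (1 + j)) x
        backward (w , nw , e) with N⇒∈closedNbhd (suc j) nw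
        ... | here refl = vertex (1 + j) , self∈N _ , e
        ... | there (here refl) = vertex (2 + j) , next∈N (1 + j) , e
        ... | there (there (here refl)) = vertex j , prev∈N j , trans eq e

      ad : c (vertex j) ≢ c (vertex (3 + j))
      ad eq = identifying (vertex (1 + j)) (vertex (2 + j)) (inj₁ (cycleSucc-vertex (1 + j)))
                nbhds-differ (same-colours eq)

  slid⇒windowSequence : ∀ {k} {c : Fin n → Fin k} → IsSlidColouring (CycleAdj n) c → WindowSequence n k
  slid⇒windowSequence {c = c} slid = record
    { colour   = c ∘ vertex
    ; periodic = cong c ∘ vertex-periodic
    ; windows  = slid⇒windows c slid
    }

  windowSequence⇒slid : ∀ {k} → WindowSequence n k → HasSlidColouring (CycleAdj n) k
  windowSequence⇒slid ws = colour ws ∘ toℕ , windows⇒slid _ (windows-≗ colour≗ (windows ws))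
    where
    colour≗ : ∀ j → colour ws j ≡ colour ws (toℕ (vertex j))
    colour≗ j = sym (trans (cong (colour ws) (toℕ-vertex j)) (periodic-% (periodic ws) j))

χslid-cycle : ∀ {n k} → 4 ≤ n → WindowSequence n (suc k) → ¬ WindowSequence n k →
  ChiSlid≡ (CycleAdj n) (suc k)
χslid-cycle 4≤n ws none = windowSequence⇒slid ws , λ m m<1+k (_ , slid) →
  none (windowSequence-mono (s≤s⁻¹ m<1+k) (slid⇒windowSequence slid))
  where open CycleColouring 4≤n

cycleTheorem : (n : ℕ) → 4 ≤ n →
  ((n % 4 ≡ 0 → ChiSlid≡ (CycleAdj n) 4) ×
   ((n ≡ 6 ⊎ n ≡ 11) → ChiSlid≡ (CycleAdj n) 6) ×
   (n ≡ 7 → ChiSlid≡ (CycleAdj n) 7) ×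
   (n % 4 ≢ 0 → n ≢ 6 → n ≢ 7 → n ≢ 11 → ChiSlid≡ (CycleAdj n) 5))
cycleTheorem n@(suc _) 4≤n =
    (λ n%4≡0 → χslid-cycle 4≤n (fourColourSequence n%4≡0) noWindowSequence-3)
  , (λ { (inj₁ refl) → χslid-cycle 4≤n (blocks⇒windowSequence (6 ∷ []) refl (6-block ∷ []))
                                       (noCyclicWord⇒noWindowSequence 3 noCyclicWord-length6-colours5)
       ; (inj₂ refl) → χslid-cycle 4≤n (blocks⇒windowSequence (5 ∷ 6 ∷ []) refl (5-block ∷ 6-block ∷ []))
                                       (noCyclicWord⇒noWindowSequence 8 noCyclicWord-length11-colours5) })
  , (λ { refl → χslid-cycle 4≤n (blocks⇒windowSequence (7 ∷ []) refl ((m≤m+n 4 3 , ≤-refl) ∷ []))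
                                (noCyclicWord⇒noWindowSequence 4 noCyclicWord-length7-colours6) })
  , λ n%4≢0 n≢6 n≢7 n≢11 → χslid-cycle 4≤n
      (fiveColourSequence (residue≤quotient (n % 4) (n / 4) (m%n<n n 4) (subst (4 ≤_) n≡r+q*4 4≤n)
        (n≢6 ∘ trans n≡r+q*4) (n≢7 ∘ trans n≡r+q*4) (n≢11 ∘ trans n≡r+q*4)))
      (n%4≢0 ∘ windowSequence4⇒n%4≡0)
  where
  n≡r+q*4 : n ≡ n % 4 + n / 4 * 4
  n≡r+q*4 = m≡m%n+[m/n]*n n 4
  5-block : 4 ≤ 5 × 5 ≤ 6
  5-block = n≤1+n 4 , n≤1+n 5
  6-block : 4 ≤ 6 × 6 ≤ 6
  6-block = m≤m+n 4 2 , ≤-refl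

-- Graphs of maximum degree two

Within3 : ∀ {n} → (Fin n → Fin n → Set) → Fin n → Fin n → Set
Within3 Adj w x = ∃₂ λ u v → InClosedNbhd Adj w u × InClosedNbhd Adj u v × InClosedNbhd Adj v x

module _ {n : ℕ} {Adj : Fin n → Fin n → Set} (Adj-sym : ∀ {u v} → Adj u v → Adj v u) where

  closedNbhd-sym : ∀ {u w} → InClosedNbhd Adj u w → InClosedNbhd Adj w u
  closedNbhd-sym (inj₁ e) = inj₁ (sym e)
  closedNbhd-sym (inj₂ a) = inj₂ (Adj-sym a)

  Within3-sym : ∀ {w x} → Within3 Adj w x → Within3 Adj x w
  Within3-sym (u , v , wu , uv , vx) = v , u , closedNbhd-sym vx , closedNbhd-sym uv , closedNbhd-sym wu

  -- A vertex distinguishing N[u] from N[v] lies within distance 3 of the vertex of N[v] carrying its colour.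
  distance3Colouring⇒slid : ∀ {k} → (∀ u → ¬ Adj u u) → (∀ u v → Dec (Adj u v)) →
    (c : Fin n → Fin k) → (∀ {w x} → Within3 Adj w x → w ≢ x → c w ≢ c x) → IsSlidColouring Adj c
  distance3Colouring⇒slid Adj-irrefl Adj? c far = (proper , identifying) , distinct
    where
    N? : ∀ u w → Dec (InClosedNbhd Adj u w)
    N? u w = (u ≟ w) ⊎-dec Adj? u w

    distinct : ∀ u v w → InClosedNbhd Adj u v → InClosedNbhd Adj u w → v ≢ w → c v ≢ c w
    distinct u v w uv uw = far (u , w , closedNbhd-sym uv , uw , inj₁ refl)

    proper : ∀ u v → Adj u v → c u ≢ c v
    proper u v a = far (u , v , inj₁ refl , inj₂ a , inj₁ refl) λ { refl → Adj-irrefl u a }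

    identifying : ∀ u v → Adj u v → ¬ SameClosedNbhd Adj u v → ¬ SameColourSet Adj c u v
    identifying u v a differ same
      with ¬∀⟶∃¬ n _ (λ w → (N? u w →-dec N? v w) ×-dec (N? v w →-dec N? u w)) differ
    ... | w , bad with N? u w | N? v w
    ... | yes uw | yes vw = bad ((λ _ → vw) , (λ _ → uw))
    ... | no ¬uw | no ¬vw = bad ((λ uw → contradiction uw ¬uw) , (λ vw → contradiction vw ¬vw))
    ... | yes uw | no ¬vw with proj₁ (same (c w)) (w , uw , refl)
    ...   | x , vx , e = far (u , v , closedNbhd-sym uw , inj₂ a , vx) (λ { refl → ¬vw vx }) (sym e)
    identifying u v a differ same | w , bad | no ¬uw | yes vw with proj₂ (same (c w)) (w , vw , refl)
    ...   | x , ux , e = far (v , u , closedNbhd-sym vw , inj₂ (Adj-sym a) , ux) (λ { refl → ¬uw ux }) (sym e)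

module Greedy {n d : ℕ} (R : Fin n → Fin n → Set) (R-sym : ∀ {v x} → R v x → R x v)
  (L : Fin n → List (Fin n)) (L-short : ∀ v → length (L v) ≤ d)
  (L-covers : ∀ {v x} → R v x → v ≢ x → x ∈ L v) where

  pick : (Fin n → Fin (suc d)) → Fin n → Fin (suc d)
  pick f v = proj₁ (freeColour (map f (L v)) (subst (_≤ d) (sym (length-map f (L v))) (L-short v)))

  pick-avoids : ∀ f v {x} → x ∈ L v → pick f v ≢ f x
  pick-avoids f v x∈ e = proj₂ (freeColour (map f (L v)) _) (subst (_∈ map f (L v)) (sym e) (∈-map⁺ f x∈))

  -- Vertices 0, …, i-1 are coloured greedily in this order; the others still have the junk colour zero.
  colourAfter : ℕ → Fin n → Fin (suc d)
  colourAfter zero    v = zero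
  colourAfter (suc i) v with toℕ v ≟ℕ i
  ... | yes _ = pick (colourAfter i) v
  ... | no  _ = colourAfter i v

  colourAfter-settled : ∀ {i} v → toℕ v < i → colourAfter i v ≡ pick (colourAfter (toℕ v)) v
  colourAfter-settled {suc i} v (s≤s v≤i) with toℕ v ≟ℕ i
  ... | yes refl = refl
  ... | no  v≢i  = colourAfter-settled v (≤∧≢⇒< v≤i v≢i)

  colouring : Fin n → Fin (suc d)
  colouring = colourAfter n

  earlier-avoided : ∀ v x → x ∈ L v → toℕ x < toℕ v → colouring v ≢ colouring x
  earlier-avoided v x x∈ x<v e = pick-avoids (colourAfter (toℕ v)) v x∈ (begin
    pick (colourAfter (toℕ v)) v   ≡⟨ colourAfter-settled v (toℕ<n v) ⟨
    colouring v                    ≡⟨ e ⟩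
    colouring x                    ≡⟨ colourAfter-settled x (toℕ<n x) ⟩
    pick (colourAfter (toℕ x)) x   ≡⟨ colourAfter-settled x x<v ⟨
    colourAfter (toℕ v) x          ∎)
    where open ≡-Reasoning

  colouring-proper : ∀ {v x} → R v x → v ≢ x → colouring v ≢ colouring x
  colouring-proper {v} {x} r v≢x with <-cmp (toℕ v) (toℕ x)
  ... | tri< v<x _ _ = earlier-avoided x v (L-covers (R-sym r) (v≢x ∘ sym)) v<x ∘ sym
  ... | tri≈ _ v≡x _ = contradiction (toℕ-injective v≡x) v≢x
  ... | tri> _ _ x<v = earlier-avoided v x (L-covers r v≢x) x<v

module DegreeAtMost2 {n : ℕ} (adj : Fin n → Fin n → Bool) (adj-sym : ∀ u v → adj u v ≡ adj v u)
  (degree≤2 : ∀ u → degree adj u ≤ 2) where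

  T-adj-sym : ∀ {u v} → T (adj u v) → T (adj v u)
  T-adj-sym {u} {v} = subst T (adj-sym u v)

  neighbours : Fin n → List (Fin n)
  neighbours v = filterᵇ (adj v) (allFin n)

  neighboursExcept : Fin n → Fin n → List (Fin n)
  neighboursExcept v w = filter (λ y → ¬? (y ≟ w)) (neighbours v)

  -- The ends of the non-backtracking walks of length 1, 2 and 3 from w: at most 2 · (1 + 1 · 2) = 6 vertices.
  ball3 : Fin n → List (Fin n)
  ball3 w = concatMap (λ a → a ∷ concatMap (λ b → b ∷ neighboursExcept b a) (neighboursExcept a w)) (neighbours w)

  ∈-neighbours : ∀ {v a} → T (adj v a) → a ∈ neighbours v
  ∈-neighbours {v} {a} = ∈-filter⁺ (T? ∘ adj v) (∈-allFin a)

  neighbour-adj : ∀ {v a} → a ∈ neighbours v → T (adj v a)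
  neighbour-adj {v} = proj₂ ∘ ∈-filter⁻ (T? ∘ adj v) {xs = allFin n}

  ∈-neighboursExcept : ∀ {v a w} → T (adj v a) → a ≢ w → a ∈ neighboursExcept v w
  ∈-neighboursExcept {w = w} t = ∈-filter⁺ (λ y → ¬? (y ≟ w)) (∈-neighbours t)

  neighboursExcept-adj : ∀ {v a w} → a ∈ neighboursExcept v w → T (adj v a)
  neighboursExcept-adj {w = w} = neighbour-adj ∘ proj₁ ∘ ∈-filter⁻ (λ y → ¬? (y ≟ w))

  neighboursExcept-short : ∀ {v w} → T (adj v w) → length (neighboursExcept v w) ≤ 1
  neighboursExcept-short {v} {w} t = s≤s⁻¹ (≤-trans
    (filter-notAll (λ y → ¬? (y ≟ w)) (neighbours v) (lose (∈-neighbours t) λ w≢w → w≢w refl)) (degree≤2 v))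

  ball3-short : ∀ w → length (ball3 w) ≤ 6
  ball3-short w = ≤-trans (length-concatMap≤ _ (neighbours w) λ a∈ → s≤s (≤-trans
      (length-concatMap≤ _ _ λ b∈ → s≤s (neighboursExcept-short (T-adj-sym (neighboursExcept-adj b∈))))
      (*-monoˡ-≤ 2 (neighboursExcept-short (T-adj-sym (neighbour-adj a∈))))))
    (*-monoˡ-≤ 3 (degree≤2 w))

  ∈ball3-1 : ∀ {w a} → T (adj w a) → a ∈ ball3 w
  ∈ball3-1 t = ∈-concatMap⁺ _ (lose (∈-neighbours t) (here refl))

  ∈ball3-2 : ∀ {w a b} → T (adj w a) → T (adj a b) → b ≢ w → b ∈ ball3 w
  ∈ball3-2 t t′ b≢w = ∈-concatMap⁺ _ (lose (∈-neighbours t)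
    (there (∈-concatMap⁺ _ (lose (∈-neighboursExcept t′ b≢w) (here refl)))))

  ∈ball3-3 : ∀ {w a b x} → T (adj w a) → T (adj a b) → b ≢ w → T (adj b x) → x ≢ a → x ∈ ball3 w
  ∈ball3-3 t t′ b≢w t″ x≢a = ∈-concatMap⁺ _ (lose (∈-neighbours t)
    (there (∈-concatMap⁺ _ (lose (∈-neighboursExcept t′ b≢w) (there (∈-neighboursExcept t″ x≢a))))))

  ball3-complete : ∀ {w x} → Within3 (BoolAdj adj) w x → w ≢ x → x ∈ ball3 w
  ball3-complete (_ , _ , inj₁ refl , inj₁ refl , inj₁ refl) w≢x = contradiction refl w≢x
  ball3-complete (_ , _ , inj₁ refl , inj₁ refl , inj₂ t)    _   = ∈ball3-1 t
  ball3-complete (_ , _ , inj₁ refl , inj₂ t    , inj₁ refl) _   = ∈ball3-1 t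
  ball3-complete (_ , _ , inj₂ t    , inj₁ refl , inj₁ refl) _   = ∈ball3-1 t
  ball3-complete (_ , _ , inj₁ refl , inj₂ t    , inj₂ t′)   w≢x = ∈ball3-2 t t′ (w≢x ∘ sym)
  ball3-complete (_ , _ , inj₂ t    , inj₁ refl , inj₂ t′)   w≢x = ∈ball3-2 t t′ (w≢x ∘ sym)
  ball3-complete (_ , _ , inj₂ t    , inj₂ t′   , inj₁ refl) w≢x = ∈ball3-2 t t′ (w≢x ∘ sym)
  ball3-complete {w} {x} (u , v , inj₂ t , inj₂ t′ , inj₂ t″) _ with v ≟ w | x ≟ u
  ... | yes refl | _        = ∈ball3-1 t″
  ... | no  v≢w  | yes refl = ∈ball3-1 t
  ... | no  v≢w  | no  x≢u  = ∈ball3-3 t t′ v≢w t″ x≢u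

  slidColouring7 : (∀ u → ¬ T (adj u u)) → HasSlidColouring (BoolAdj adj) 7
  slidColouring7 irrefl =
    colouring , distance3Colouring⇒slid T-adj-sym irrefl (λ u v → T? (adj u v)) colouring colouring-proper
    where open Greedy (Within3 (BoolAdj adj)) (Within3-sym T-adj-sym) ball3 ball3-short ball3-complete

mainTheorem8 : ((n : ℕ) → 4 ≤ n →
    ((n % 4 ≡ 0 → ChiSlid≡ (CycleAdj n) 4) ×
     ((n ≡ 6 ⊎ n ≡ 11) → ChiSlid≡ (CycleAdj n) 6) ×
     (n ≡ 7 → ChiSlid≡ (CycleAdj n) 7) ×
     (n % 4 ≢ 0 → n ≢ 6 → n ≢ 7 → n ≢ 11 → ChiSlid≡ (CycleAdj n) 5)))
  ×
  ((n : ℕ) (adj : Fin n → Fin n → Bool) → IsSimpleGraph adj → MaxDegree2 adj →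
    HasSlidColouring (BoolAdj adj) 7)
mainTheorem8 = cycleTheorem , λ n adj (adj-sym , irrefl) (degree≤2 , _) →
  DegreeAtMost2.slidColouring7 adj adj-sym degree≤2 irrefl
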